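{- Let $\mathsf V$ be a 1ESP variety and $h$ an algebraic e-generalization problem for $\mathsf V$. Then the e-generalization type of $h$ equals the type of $\mathscr G(h)$.
   Context: $\mathbf F_{\mathsf V}(z)$ is the 1-generated free algebra of $\mathsf V$. Projective = retract of a free algebra; exact = isomorphic to a finitely generated subalgebra of a finitely generated free algebra. An algebraic e-generalization problem is a homomorphism $h:\mathbf F_{\mathsf V}(z)\to\prod_{k=1}^m\mathbf E_k$ ($m\ge1$), each $\mathbf E_k$ 1-generated exact, each $p_k\circ h$ surjective. A solution is a homomorphism $g:\mathbf F_{\mathsf V}(z)\to\mathbf P$, $\mathbf P$ finitely generated projective, with $f\circ g=h$ for some $f$; $g\sqsubseteq g'$ iff $f\circ g'=g$ for some homomorphism $f$. The type of $h$ is unitary/finitary/infinitary/nullary according as the poset of solutions modulo equal generality has a minimal complete set (pairwise incomparable elements such that every element is $\sqsupseteq$ one of them) of cardinality 1 / finite $>1$ / infinite / none. $\mathscr G(h)=\{\ker(g):g\text{ a solution}\}$; its type is defined the same way using maximal complete sets (pairwise incomparable elements such that every element is $\subseteq$ one of them) of $(\mathscr G(h),\subseteq)$. $\mathbf S$ is strongly projective if projective and every embedding $i:\mathbf S\to\mathbf P$ into a projective $\mathbf P$ has a homomorphism $j$ with $j\circ i=\mathrm{id}_{\mathbf S}$; $\mathsf V$ is 1ESP if all its 1-generated exact algebras are strongly projective. -}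

module Defs where

open import Level using (Level; 0ℓ) renaming (suc to lsuc)
open import Data.Nat using (ℕ; _≤_)
open import Data.Fin using (Fin)
open import Data.Unit using (⊤; tt)
open import Data.Product using (Σ; ∃; ∃-syntax; _×_; _,_)
open import Relation.Binary using (Rel; IsEquivalence)
open import Relation.Binary.PropositionalEquality using (_≡_)
open import Relation.Nullary using (¬_)
open import Function.Bundles using (_↔_)

record Signature : Set₁ where
  field
    Op    : Set
    arity : Op → ℕ
open Signature public

record Algebra (σ : Signature) : Set₁ where
  field
    Carrier       : Set
    _≈_           : Rel Carrier 0ℓ
    isEquivalence : IsEquivalence _≈_
    ⟦_⟧           : (f : Op σ) → (Fin (arity σ f) → Carrier) → Carrier
    ⟦⟧-cong       : ∀ f {xs ys : Fin (arity σ f) → Carrier} →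
                    (∀ i → xs i ≈ ys i) → ⟦ f ⟧ xs ≈ ⟦ f ⟧ ys

∣_∣ : {σ : Signature} → Algebra σ → Set
∣ A ∣ = Algebra.Carrier A

data Term (σ : Signature) (X : Set) : Set where
  var : X → Term σ X
  op  : (f : Op σ) → (Fin (arity σ f) → Term σ X) → Term σ X

module _ {σ : Signature} where

  eval : (A : Algebra σ) {X : Set} → (X → ∣ A ∣) → Term σ X → ∣ A ∣
  eval A ρ (var x)   = ρ x
  eval A ρ (op f ts) = Algebra.⟦_⟧ A f (λ i → eval A ρ (ts i))

  _[_] : {X Y : Set} → Term σ Y → (Y → Term σ X) → Term σ X
  var y   [ s ] = s y
  op f ts [ s ] = op f (λ i → ts i [ s ])

  record Hom (A B : Algebra σ) : Set where
    field
      fun       : ∣ A ∣ → ∣ B ∣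
      fun-cong  : ∀ {x y} → Algebra._≈_ A x y → Algebra._≈_ B (fun x) (fun y)
      preserves : ∀ f (xs : Fin (arity σ f) → ∣ A ∣) →
                  Algebra._≈_ B (fun (Algebra.⟦_⟧ A f xs))
                                (Algebra.⟦_⟧ B f (λ i → fun (xs i)))
  open Hom public

  idₕ : (A : Algebra σ) → Hom A A
  idₕ A = record
    { fun = λ x → x
    ; fun-cong = λ p → p
    ; preserves = λ f xs → IsEquivalence.refl (Algebra.isEquivalence A) }

  _∘ₕ_ : {A B C : Algebra σ} → Hom B C → Hom A B → Hom A C
  _∘ₕ_ {A} {B} {C} g f = record
    { fun = λ x → fun g (fun f x)
    ; fun-cong = λ p → fun-cong g (fun-cong f p)
    ; preserves = λ o xs →
        IsEquivalence.trans (Algebra.isEquivalence C)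
          (fun-cong g (preserves f o xs)) (preserves g o (λ i → fun f (xs i))) }

  _≗ₕ_ : {A B : Algebra σ} → Hom A B → Hom A B → Set
  _≗ₕ_ {B = B} g g' = ∀ x → Algebra._≈_ B (fun g x) (fun g' x)

  Surjective : {A B : Algebra σ} → Hom A B → Set
  Surjective {A} {B} g = ∀ (b : ∣ B ∣) → ∃[ a ] Algebra._≈_ B (fun g a) b

  Injective : {A B : Algebra σ} → Hom A B → Set
  Injective {A} {B} g = ∀ x y → Algebra._≈_ B (fun g x) (fun g y) → Algebra._≈_ A x y

  GeneratedBy : (A : Algebra σ) {n : ℕ} → (Fin n → ∣ A ∣) → Set
  GeneratedBy A {n} gs = ∀ (a : ∣ A ∣) → ∃[ t ] Algebra._≈_ A (eval A {Fin n} gs t) a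

  FinitelyGenerated : Algebra σ → Set
  FinitelyGenerated A = ∃[ n ] Σ (Fin n → ∣ A ∣) (GeneratedBy A)

  OneGenerated : Algebra σ → Set
  OneGenerated A = Σ (Fin 1 → ∣ A ∣) (GeneratedBy A)

  Prod : {m : ℕ} → (Fin m → Algebra σ) → Algebra σ
  Prod {m} E = record
    { Carrier = (k : Fin m) → ∣ E k ∣
    ; _≈_ = λ x y → ∀ k → Algebra._≈_ (E k) (x k) (y k)
    ; isEquivalence = record
      { refl  = λ k → IsEquivalence.refl (Algebra.isEquivalence (E k))
      ; sym   = λ p k → IsEquivalence.sym (Algebra.isEquivalence (E k)) (p k)
      ; trans = λ p q k → IsEquivalence.trans (Algebra.isEquivalence (E k)) (p k) (q k) }
    ; ⟦_⟧ = λ f xs k → Algebra.⟦_⟧ (E k) f (λ i → xs i k)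
    ; ⟦⟧-cong = λ f p k → Algebra.⟦⟧-cong (E k) f (λ i → p i k) }

  proj : {m : ℕ} (E : Fin m → Algebra σ) (k : Fin m) → Hom (Prod E) (E k)
  proj E k = record
    { fun = λ x → x k
    ; fun-cong = λ p → p k
    ; preserves = λ f xs → IsEquivalence.refl (Algebra.isEquivalence (E k)) }

record Variety (σ : Signature) : Set₁ where
  field
    Axiom    : Set
    lhs rhs  : Axiom → Term σ ℕ
open Variety public

module _ {σ : Signature} where

  _∈V_ : Algebra σ → Variety σ → Set
  A ∈V V = ∀ (a : Axiom V) (ρ : ℕ → ∣ A ∣) →
           Algebra._≈_ A (eval A ρ (lhs V a)) (eval A ρ (rhs V a))

  data _⊢_≈_ (V : Variety σ) {X : Set} : Term σ X → Term σ X → Set where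
    ≈refl  : ∀ {t} → V ⊢ t ≈ t
    ≈sym   : ∀ {s t} → V ⊢ s ≈ t → V ⊢ t ≈ s
    ≈trans : ∀ {s t u} → V ⊢ s ≈ t → V ⊢ t ≈ u → V ⊢ s ≈ u
    ≈cong  : ∀ f {ss ts : Fin (arity σ f) → Term σ X} →
             (∀ i → V ⊢ ss i ≈ ts i) → V ⊢ op f ss ≈ op f ts
    ≈axiom : ∀ (a : Axiom V) (s : ℕ → Term σ X) →
             V ⊢ (lhs V a [ s ]) ≈ (rhs V a [ s ])

  Free : Variety σ → Set → Algebra σ
  Free V X = record
    { Carrier = Term σ X
    ; _≈_ = V ⊢_≈_
    ; isEquivalence = record { refl = ≈refl ; sym = ≈sym ; trans = ≈trans }
    ; ⟦_⟧ = op
    ; ⟦⟧-cong = ≈cong }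

  F₁ : Variety σ → Algebra σ
  F₁ V = Free V ⊤

  IsProjective : Variety σ → Algebra σ → Set₁
  IsProjective V P = ∃ λ (X : Set) → ∃ λ (i : Hom P (Free V X)) →
                     ∃ λ (r : Hom (Free V X) P) → (r ∘ₕ i) ≗ₕ idₕ P

  -- exact = isomorphic to a finitely generated subalgebra of a finitely
  -- generated free algebra (i.e. f.g. and embeddable into some F_V(Fin n))
  IsExact : Variety σ → Algebra σ → Set
  IsExact V E = FinitelyGenerated E ×
                ∃ λ (n : ℕ) → ∃ λ (e : Hom E (Free V (Fin n))) → Injective e

  IsStronglyProjective : Variety σ → Algebra σ → Set₁
  IsStronglyProjective V S =
    IsProjective V S ×
    (∀ (P : Algebra σ) → IsProjective V P → (i : Hom S P) → Injective i →
       ∃ λ (j : Hom P S) → (j ∘ₕ i) ≗ₕ idₕ S)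

  OneESP : Variety σ → Set₁
  OneESP V = ∀ (E : Algebra σ) → OneGenerated E → IsExact V E →
             IsStronglyProjective V E

  record AlgEGenProblem (V : Variety σ) : Set₁ where
    field
      m       : ℕ
      1≤m     : 1 ≤ m
      E       : Fin m → Algebra σ
      E-1gen  : ∀ k → OneGenerated (E k)
      E-exact : ∀ k → IsExact V (E k)
      h       : Hom (F₁ V) (Prod E)
      h-surj  : ∀ k → Surjective (proj E k ∘ₕ h)

  module _ {V : Variety σ} (H : AlgEGenProblem V) where
    open AlgEGenProblem H

    record Solution : Set₁ where
      field
        P      : Algebra σ
        P-fg   : FinitelyGenerated P
        P-proj : IsProjective V P
        g      : Hom (F₁ V) P
        factor : ∃ λ (f : Hom P (Prod E)) → (f ∘ₕ g) ≗ₕ h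

    _⊑_ : Solution → Solution → Set
    s ⊑ s' = ∃ λ (f : Hom (Solution.P s') (Solution.P s)) →
             (f ∘ₕ Solution.g s') ≗ₕ Solution.g s

    ker : Solution → Rel (Term σ ⊤) 0ℓ
    ker s x y = Algebra._≈_ (Solution.P s) (fun (Solution.g s) x) (fun (Solution.g s) y)

    -- elements of 𝒢(h): relations on F_V(z) equal (as sets) to ker(g) for a solution g
    record GElem : Set₁ where
      field
        θ   : Rel (Term σ ⊤) 0ℓ
        sol : ∃ λ (s : Solution) →
              (∀ x y → θ x y → ker s x y) × (∀ x y → ker s x y → θ x y)

    _⊆G_ : GElem → GElem → Set
    a ⊆G b = ∀ x y → GElem.θ a x y → GElem.θ b x y

data UnifType : Set where
  unitary finitary infinitary nullary : UnifType

module _ {a : Level} {A : Set a} (_≼_ : A → A → Set) where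

  -- an indexed family of pairwise incomparable elements such that every
  -- element is ≥ one of them (a minimal complete set; indices are distinct
  -- classes modulo ≤-equivalence because of incomparability)
  IsMinimalComplete : {I : Set a} → (I → A) → Set a
  IsMinimalComplete {I} M =
    (∀ (i j : I) → ¬ i ≡ j → ¬ (M i ≼ M j)) × (∀ (x : A) → ∃[ i ] (M i ≼ x))

  HasTypeMin : UnifType → Set (lsuc a)
  HasTypeMin unitary    = ∃ λ (I : Set a) → ∃ λ (M : I → A) →
                          IsMinimalComplete M × (I ↔ Fin 1)
  HasTypeMin finitary   = ∃ λ (I : Set a) → ∃ λ (M : I → A) →
                          IsMinimalComplete M × ∃ λ (n : ℕ) → (2 ≤ n) × (I ↔ Fin n)
  HasTypeMin infinitary = ∃ λ (I : Set a) → ∃ λ (M : I → A) →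
                          IsMinimalComplete M × (∀ (n : ℕ) → ¬ (I ↔ Fin n))
  HasTypeMin nullary    = ¬ (∃ λ (I : Set a) → ∃ λ (M : I → A) → IsMinimalComplete M)

HasTypeMax : {a : Level} {A : Set a} → (A → A → Set) → UnifType → Set (lsuc a)
HasTypeMax _≼_ = HasTypeMin (λ x y → y ≼ x)

-- A solution g factors through any solution g' with ker g' ⊆ ker g: the image
-- F(z)/ker g' of g' is 1-generated, and it is exact because it embeds into the
-- finitely generated projective algebra P', which in turn embeds into a finitely
-- generated free algebra.  By 1ESP the embedding F(z)/ker g' → P' has a retraction
-- j, and g factors as F(z)/ker g' → P composed with j.  Hence g ⊑ g' iff
-- ker g' ⊆ ker g, so g ↦ ker g is an equivalence between the preorder of solutions
-- and (𝒢(h), ⊇), and equivalent preorders have the same minimal complete sets.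
module Submission where

open import Defs
open import Level using (Level; 0ℓ)
open import Data.Nat using (ℕ)
open import Data.Fin using (Fin; zero)
open import Data.Unit using (⊤; tt)
open import Data.Product using (∃; _×_; _,_; proj₁; proj₂)
open import Function using (_∘_; flip)
open import Function.Bundles using (_⇔_; mk⇔)
open import Relation.Binary using (Setoid; Transitive)
import Relation.Binary.Reasoning.Setoid as SetoidReasoning

module _ {σ : Signature} where

  setoid : Algebra σ → Setoid 0ℓ 0ℓ
  setoid A = record
    { Carrier = ∣ A ∣ ; _≈_ = Algebra._≈_ A ; isEquivalence = Algebra.isEquivalence A }

  module _ {A B : Algebra σ} where
    open Setoid (setoid B)

    eval-hom : {X : Set} (h : Hom A B) (ρ : X → ∣ A ∣) (t : Term σ X) →
               fun h (eval A ρ t) ≈ eval B (fun h ∘ ρ) t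
    eval-hom h ρ (var x)   = refl
    eval-hom h ρ (op f ts) =
      trans (preserves h f _) (Algebra.⟦⟧-cong B f (λ i → eval-hom h ρ (ts i)))

    surjective-generatedBy : {n : ℕ} (h : Hom A B) → Surjective h →
                             (gs : Fin n → ∣ A ∣) → GeneratedBy A gs →
                             GeneratedBy B (fun h ∘ gs)
    surjective-generatedBy h h-surj gs gen b =
      let (a , ha≈b) = h-surj b
          (t , t≈a)  = gen a
      in t , trans (sym (eval-hom h gs t)) (trans (fun-cong h t≈a) ha≈b)

    leftInverse⇒injective : (e : Hom A B) (r : Hom B A) → (r ∘ₕ e) ≗ₕ idₕ A →
                            Injective e
    leftInverse⇒injective e r r∘e≗id x y ex≈ey = begin
      x                ≈⟨ r∘e≗id x ⟨
      fun r (fun e x)  ≈⟨ fun-cong r ex≈ey ⟩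
      fun r (fun e y)  ≈⟨ r∘e≗id y ⟩
      y                ∎
      where open SetoidReasoning (setoid A)

  ∘ₕ-injective : {A B C : Algebra σ} (g : Hom B C) (f : Hom A B) →
                 Injective g → Injective f → Injective (g ∘ₕ f)
  ∘ₕ-injective g f g-inj f-inj x y = f-inj x y ∘ g-inj (fun f x) (fun f y)

  _⊆ker_ : {A B C : Algebra σ} → Hom A B → Hom A C → Set
  _⊆ker_ {A} {B} {C} g h =
    ∀ x y → Algebra._≈_ B (fun g x) (fun g y) → Algebra._≈_ C (fun h x) (fun h y)

  factors⇒⊆ker : {A B C : Algebra σ} (g : Hom A B) (h : Hom A C) (f : Hom B C) →
                 (f ∘ₕ g) ≗ₕ h → g ⊆ker h
  factors⇒⊆ker {C = C} g h f f∘g≗h x y gx≈gy = begin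
    fun h x          ≈⟨ f∘g≗h x ⟨
    fun f (fun g x)  ≈⟨ fun-cong f gx≈gy ⟩
    fun f (fun g y)  ≈⟨ f∘g≗h y ⟩
    fun h y          ∎
    where open SetoidReasoning (setoid C)

  -- A / ker g, isomorphic to the image of g.
  Coimage : {A B : Algebra σ} → Hom A B → Algebra σ
  Coimage {A} {B} g = record
    { Carrier       = ∣ A ∣
    ; _≈_           = λ x y → fun g x ≈ fun g y
    ; isEquivalence = record { refl = refl ; sym = sym ; trans = trans }
    ; ⟦_⟧           = Algebra.⟦_⟧ A
    ; ⟦⟧-cong       = λ f {xs} {ys} xs≈ys →
        trans (preserves g f xs)
          (trans (Algebra.⟦⟧-cong B f xs≈ys) (sym (preserves g f ys)))
    }
    where open Setoid (setoid B)

  module _ {A B : Algebra σ} (g : Hom A B) where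

    coimage-quotient : Hom A (Coimage g)
    coimage-quotient = record
      { fun       = λ x → x
      ; fun-cong  = fun-cong g
      ; preserves = λ f xs → Setoid.refl (setoid B)
      }

    coimage-quotient-surjective : Surjective coimage-quotient
    coimage-quotient-surjective b = b , Setoid.refl (setoid B)

    coimage-oneGenerated : OneGenerated A → OneGenerated (Coimage g)
    coimage-oneGenerated (gs , gen) =
      gs , surjective-generatedBy coimage-quotient coimage-quotient-surjective gs gen

    coimage-embedding : Hom (Coimage g) B
    coimage-embedding = record
      { fun = fun g ; fun-cong = λ p → p ; preserves = preserves g }

    coimage-embedding-injective : Injective coimage-embedding
    coimage-embedding-injective x y p = p

    coimage-lift : {C : Algebra σ} (h : Hom A C) → g ⊆ker h → Hom (Coimage g) C
    coimage-lift h g⊆h = record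
      { fun = fun h ; fun-cong = λ {x} {y} → g⊆h x y ; preserves = preserves h }

    ⊆ker⇒factors : {C : Algebra σ} (h : Hom A C) (g⊆h : g ⊆ker h)
                   (j : Hom B (Coimage g)) →
                   (j ∘ₕ coimage-embedding) ≗ₕ idₕ (Coimage g) →
                   ((coimage-lift h g⊆h ∘ₕ j) ∘ₕ g) ≗ₕ h
    ⊆ker⇒factors h g⊆h j j-retraction x = g⊆h (fun j (fun g x)) x (j-retraction x)

module _ {σ : Signature} {V : Variety σ} where

  []-assoc : {X Y Z : Set} (t : Term σ Z) (s : Z → Term σ Y) (ρ : Y → Term σ X) →
             V ⊢ ((t [ s ]) [ ρ ]) ≈ (t [ (λ z → s z [ ρ ]) ])
  []-assoc (var z)   s ρ = ≈refl
  []-assoc (op f ts) s ρ = ≈cong f (λ i → []-assoc (ts i) s ρ)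

  ⊢-[] : {X Y : Set} {a b : Term σ Y} (ρ : Y → Term σ X) →
         V ⊢ a ≈ b → V ⊢ (a [ ρ ]) ≈ (b [ ρ ])
  ⊢-[] ρ ≈refl          = ≈refl
  ⊢-[] ρ (≈sym p)       = ≈sym (⊢-[] ρ p)
  ⊢-[] ρ (≈trans p q)   = ≈trans (⊢-[] ρ p) (⊢-[] ρ q)
  ⊢-[] ρ (≈cong f ps)   = ≈cong f (λ i → ⊢-[] ρ (ps i))
  ⊢-[] ρ (≈axiom a s)   =
    ≈trans ([]-assoc (lhs V a) s ρ)
      (≈trans (≈axiom a (λ z → s z [ ρ ])) (≈sym ([]-assoc (rhs V a) s ρ)))

  substₕ : {X Y : Set} → (Y → Term σ X) → Hom (Free V Y) (Free V X)
  substₕ ρ = record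
    { fun = _[ ρ ] ; fun-cong = ⊢-[] ρ ; preserves = λ f ts → ≈refl }

  F₁-oneGenerated : OneGenerated (F₁ V)
  F₁-oneGenerated = (λ _ → var tt) , λ t → t [ (λ _ → var zero) ] , eval-rename t
    where
      eval-rename : (t : Term σ ⊤) →
                    V ⊢ eval (F₁ V) (λ _ → var tt) (t [ (λ _ → var zero) ]) ≈ t
      eval-rename (var _)   = ≈refl
      eval-rename (op f ts) = ≈cong f (λ i → eval-rename (ts i))

  -- Pick for each variable x a term τ x over the generators of P denoting r x;
  -- substituting τ and then the generators back is undone by the retraction r.
  fgProjective-embedsInFgFree :
    {P : Algebra σ} → IsProjective V P → FinitelyGenerated P →
    ∃ λ n → ∃ λ (e : Hom P (Free V (Fin n))) → Injective e
  fgProjective-embedsInFgFree {P} (X , i , r , r∘i≗id) (n , gs , gen) =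
    n , substₕ τ ∘ₕ i ,
    leftInverse⇒injective (substₕ τ ∘ₕ i) (r ∘ₕ substₕ (fun i ∘ gs))
      (λ p → trans (r-resubst (fun i p)) (r∘i≗id p))
    where
      open Setoid (setoid P)

      τ : X → Term σ (Fin n)
      τ x = proj₁ (gen (fun r (var x)))

      r-subst-generators : (a : Term σ (Fin n)) →
                           fun r (a [ fun i ∘ gs ]) ≈ eval P gs a
      r-subst-generators (var k)   = r∘i≗id (gs k)
      r-subst-generators (op f as) =
        trans (preserves r f _) (Algebra.⟦⟧-cong P f (λ k → r-subst-generators (as k)))

      r-resubst : (t : Term σ X) → fun r ((t [ τ ]) [ fun i ∘ gs ]) ≈ fun r t
      r-resubst (var x)   =
        trans (r-subst-generators (τ x)) (proj₂ (gen (fun r (var x))))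
      r-resubst (op f ts) =
        trans (preserves r f _)
          (trans (Algebra.⟦⟧-cong P f (λ k → r-resubst (ts k)))
                 (sym (preserves r f ts)))

  coimage-exact : {A P : Algebra σ} (g : Hom A P) → OneGenerated A →
                  IsProjective V P → FinitelyGenerated P → IsExact V (Coimage g)
  coimage-exact g A-1gen P-proj P-fg =
    let (n , e , e-inj) = fgProjective-embedsInFgFree P-proj P-fg
    in  (1 , coimage-oneGenerated g A-1gen) , n , e ∘ₕ coimage-embedding g ,
        ∘ₕ-injective e (coimage-embedding g) e-inj (coimage-embedding-injective g)

module _ {a : Level} {A B : Set a} {_≼_ : A → A → Set} {_≤_ : B → B → Set}
         (≤-trans : Transitive _≤_) (f : A → B) (g : B → A)
         (f-mono : ∀ x y → x ≼ y → f x ≤ f y)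
         (f-reflects : ∀ x y → f x ≤ f y → x ≼ y)
         (f∘g≤id : ∀ b → f (g b) ≤ b) (id≤f∘g : ∀ b → b ≤ f (g b)) where

  isMinimalComplete-map : {I : Set a} {M : I → A} →
                          IsMinimalComplete _≼_ M → IsMinimalComplete _≤_ (f ∘ M)
  isMinimalComplete-map {M = M} (incomparable , complete) =
    (λ i j i≢j → incomparable i j i≢j ∘ f-reflects (M i) (M j)) ,
    (λ b → let (i , Mi≼gb) = complete (g b)
           in  i , ≤-trans (f-mono (M i) (g b) Mi≼gb) (f∘g≤id b))

  isMinimalComplete-comap : {I : Set a} {M : I → B} →
                            IsMinimalComplete _≤_ M → IsMinimalComplete _≼_ (g ∘ M)
  isMinimalComplete-comap {M = M} (incomparable , complete) =
    (λ i j i≢j gMi≼gMj → incomparable i j i≢j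
       (≤-trans (id≤f∘g (M i))
          (≤-trans (f-mono (g (M i)) (g (M j)) gMi≼gMj) (f∘g≤id (M j))))) ,
    (λ x → let (i , Mi≤fx) = complete (f x)
           in  i , f-reflects (g (M i)) x (≤-trans (f∘g≤id (M i)) Mi≤fx))

  private
    push : {C : Set a → Set a} →
           (∃ λ I → ∃ λ (M : I → A) → IsMinimalComplete _≼_ M × C I) →
           (∃ λ I → ∃ λ (M : I → B) → IsMinimalComplete _≤_ M × C I)
    push (I , M , mc , c) = I , f ∘ M , isMinimalComplete-map mc , c

    pull : {C : Set a → Set a} →
           (∃ λ I → ∃ λ (M : I → B) → IsMinimalComplete _≤_ M × C I) →
           (∃ λ I → ∃ λ (M : I → A) → IsMinimalComplete _≼_ M × C I)
    pull (I , M , mc , c) = I , g ∘ M , isMinimalComplete-comap mc , c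

  hasTypeMin-⇔ : ∀ t → HasTypeMin _≼_ t ⇔ HasTypeMin _≤_ t
  hasTypeMin-⇔ unitary    = mk⇔ push pull
  hasTypeMin-⇔ finitary   = mk⇔ push pull
  hasTypeMin-⇔ infinitary = mk⇔ push pull
  hasTypeMin-⇔ nullary    =
    mk⇔ (λ no (I , M , mc) → no (I , g ∘ M , isMinimalComplete-comap mc))
        (λ no (I , M , mc) → no (I , f ∘ M , isMinimalComplete-map mc))

module _ {σ : Signature} {V : Variety σ} (H : AlgEGenProblem V) where
  open Solution

  ⊑⇒⊆ker : ∀ s s' → _⊑_ H s s' → g s' ⊆ker g s
  ⊑⇒⊆ker s s' (f , f∘g'≗g) = factors⇒⊆ker (g s') (g s) f f∘g'≗g

  ⊆ker⇒⊑ : OneESP V → ∀ s s' → g s' ⊆ker g s → _⊑_ H s s'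
  ⊆ker⇒⊑ esp s s' g'⊆g =
    let g' = g s'
        (_ , has-retractions) =
          esp (Coimage g') (coimage-oneGenerated g' F₁-oneGenerated)
              (coimage-exact g' F₁-oneGenerated (P-proj s') (P-fg s'))
        (j , j-retraction) =
          has-retractions (P s') (P-proj s') (coimage-embedding g')
                          (coimage-embedding-injective g')
    in  coimage-lift g' (g s) g'⊆g ∘ₕ j ,
        ⊆ker⇒factors g' (g s) g'⊆g j j-retraction

  kernelOf : Solution H → GElem H
  kernelOf s = record { θ = ker H s ; sol = s , (λ _ _ p → p) , (λ _ _ p → p) }

  solutionOf : GElem H → Solution H
  solutionOf θ = proj₁ (GElem.sol θ)

  ⊆G-kernelOf-solutionOf : ∀ θ → _⊆G_ H θ (kernelOf (solutionOf θ))
  ⊆G-kernelOf-solutionOf θ = proj₁ (proj₂ (GElem.sol θ))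

  kernelOf-solutionOf-⊆G : ∀ θ → _⊆G_ H (kernelOf (solutionOf θ)) θ
  kernelOf-solutionOf-⊆G θ = proj₂ (proj₂ (GElem.sol θ))

corollary4p20 : {σ : Signature} (V : Variety σ) → OneESP V →
    (H : AlgEGenProblem V) → (t : UnifType) →
    HasTypeMin (_⊑_ H) t ⇔ HasTypeMax (_⊆G_ H) t
corollary4p20 V esp H =
  hasTypeMin-⇔ {_≼_ = _⊑_ H} {_≤_ = flip (_⊆G_ H)}
    (λ θ⊇θ′ θ′⊇θ″ x y → θ⊇θ′ x y ∘ θ′⊇θ″ x y) (kernelOf H) (solutionOf H)
    (⊑⇒⊆ker H) (⊆ker⇒⊑ H esp)
    (⊆G-kernelOf-solutionOf H) (kernelOf-solutionOf-⊆G H)
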